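{- Let $p\in\mathbb{NPE}$. Then $\exists n_0\in\mathbb{N}.\ \forall n\in\mathbb{N}_{>n_0}.\ p>0$ holds if and only if $\lim_{n\to\infty}p>0$.
   Context: $n$ is a variable over $\mathbb{N}$. $\mathbb{NPE}$ is the set of expressions $\sum_{j=1}^{\ell}\alpha_j\cdot n^{a_j}\cdot b_j^n$ with $\ell,a_j\in\mathbb{N}$, $\alpha_j\in\mathbb{Q}$, $b_j\in\mathbb{N}_{\ge1}$ (such limits exist in $\mathbb{Q}\cup\{\pm\infty\}$). -}

module Defs where

open import Data.Nat as ℕ using (ℕ; _^_; _≥_)
open import Data.Integer using (+_)
open import Data.Rational using (ℚ; 0ℚ; _/_; _+_; _*_; _-_; ∣_∣; _<_; _>_)
open import Data.List using (List; foldr)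
open import Data.Product using (Σ; _×_)
open import Data.Sum using (_⊎_)

ℕ→ℚ : ℕ → ℚ
ℕ→ℚ k = (+ k) / 1

-- One summand  α · n^a · b^n  with α ∈ ℚ, a ∈ ℕ, b ∈ ℕ≥1
record Term : Set where
  constructor term
  field
    α   : ℚ
    a   : ℕ
    b   : ℕ
    b≥1 : b ≥ 1

NPE : Set
NPE = List Term

evalTerm : Term → ℕ → ℚ
evalTerm (term α a b _) n = α * ℕ→ℚ (n ^ a ℕ.* b ^ n)

eval : NPE → ℕ → ℚ
eval p n = foldr (λ t acc → evalTerm t n + acc) 0ℚ p

_⟶_ : (ℕ → ℚ) → ℚ → Set
f ⟶ c = ∀ (ε : ℚ) → ε > 0ℚ → Σ ℕ λ N → ∀ n → n ≥ N → ∣ f n - c ∣ < ε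

_⟶+∞ : (ℕ → ℚ) → Set
f ⟶+∞ = ∀ (M : ℚ) → Σ ℕ λ N → ∀ n → n ≥ N → f n > M

LimPositive : (ℕ → ℚ) → Set
LimPositive f = f ⟶+∞ ⊎ Σ ℚ λ c → (c > 0ℚ) × (f ⟶ c)

EventuallyPositive : (ℕ → ℚ) → Set
EventuallyPositive f = Σ ℕ λ n₀ → ∀ n → n ℕ.> n₀ → f n > 0ℚ

module Submission where

-- The direction "positive limit ⇒ eventually positive" holds for every rational
-- sequence and is immediate from the definitions of the two kinds of limit.
--
-- For the converse we show that every p ∈ NPE is either identically zero or has a
-- leading term: p(n) ~ α · n^a · b^n with α ≠ 0, meaning the difference is o(n^a · b^n).
-- The leading key (b , a) is the lexicographically largest key of p whose summands do
-- not cancel; the underlying growth fact is that a lexicographically smaller key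
-- (b′ , a′) gives a weight that is eventually below every fraction of n^a · b^n
-- (proved in ℕ via binomial coefficients, since C(n, k+1) · c^n ≤ (c+1)^n · c^(k+1)).
-- An eventually positive p is then not identically zero, its leading coefficient α is
-- positive, and p converges to α if (b , a) = (1 , 0) and diverges to +∞ otherwise.

open import Defs
open import Data.Nat as ℕ using (ℕ; zero; suc; z≤n; s≤s)
import Data.Nat.Properties as ℕₚ
open import Data.Product using (Σ; _×_; _,_; proj₁; proj₂; uncurry)
open import Data.Product.Properties using (≡-dec)
import Data.Product.Relation.Binary.Lex.Strict as LexStrict
import Data.Product.Relation.Binary.Lex.NonStrict as LexNonStrict
open import Data.Sum using (_⊎_; inj₁; inj₂)
open import Data.Empty using (⊥-elim)
open import Data.List using ([]; _∷_; length; filter)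
open import Data.List.Properties using (filter-notAll)
open import Data.List.Relation.Unary.Any as Any using (Any; here; there)
open import Data.List.Relation.Unary.All as All using (All; []; _∷_)
open import Data.List.Relation.Unary.All.Properties using (all-filter; filter⁺)
open import Data.List.Extrema (LexNonStrict.×-totalOrder ℕₚ.≤-decTotalOrder ℕₚ.≤-totalOrder)
  using (argmax; f[⊥]≤f[argmax]; f[xs]≤f[argmax]; argmax-sel; argmax-all)
open import Induction.WellFounded using (Acc; acc)
open import Data.Nat.Induction using (<-wellFounded)
open import Relation.Nullary using (¬_; Dec; yes; no; ¬?)
open import Relation.Binary.Definitions using (tri<; tri≈; tri>)
open import Relation.Binary.PropositionalEquality

Eventually : (ℕ → Set) → Set
Eventually P = Σ ℕ λ N → ∀ n → n ℕ.≥ N → P n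

eventually-map : ∀ {P Q : ℕ → Set} → (∀ {n} → P n → Q n) → Eventually P → Eventually Q
eventually-map f (N , p) = N , λ n n≥N → f (p n n≥N)

eventually-both : ∀ {P Q : ℕ → Set} → Eventually P → Eventually Q → Eventually (λ n → P n × Q n)
eventually-both (M , p) (N , q) =
  M ℕ.⊔ N , λ n n≥ → p n (ℕₚ.m⊔n≤o⇒m≤o M N n≥) , q n (ℕₚ.m⊔n≤o⇒n≤o M N n≥)

-- Keys (b , a) index the summands n^a · b^n; they are ordered lexicographically,
-- the base b first, because a larger base beats every polynomial factor.
Key : Set
Key = ℕ × ℕ

weightℕ : Key → ℕ → ℕ
weightℕ (b , a) n = n ℕ.^ a ℕ.* b ℕ.^ n

_≺_ : Key → Key → Set
_≺_ = LexStrict.×-Lex _≡_ ℕ._<_ ℕ._<_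

module Growth where

  open import Data.Nat
  open import Data.Nat.Properties
  open import Data.Nat.Solver using (module +-*-Solver)
  open +-*-Solver using (solve; _:=_; _:+_; _:*_; con)

  -- Binomial coefficients, defined by Pascal's rule so that they can be used
  -- directly in inductions (the library's _C_ is defined through factorials).
  _choose_ : ℕ → ℕ → ℕ
  n     choose zero  = 1
  zero  choose suc k = 0
  suc n choose suc k = n choose k + n choose suc k

  choose-1 : ∀ n → n choose 1 ≡ n
  choose-1 zero    = refl
  choose-1 (suc n) = cong suc (choose-1 n)

  choose-absorb : ∀ n j → suc j * (suc n choose suc j) ≡ suc n * (n choose j)
  choose-absorb zero    zero    = refl
  choose-absorb zero    (suc j) = *-zeroʳ (suc (suc j))
  choose-absorb (suc m) zero    = begin
    1 * (suc (suc m) choose 1) ≡⟨ *-identityˡ _ ⟩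
    suc (suc m) choose 1       ≡⟨ choose-1 (suc (suc m)) ⟩
    suc (suc m)                ≡⟨ *-identityʳ _ ⟨
    suc (suc m) * 1            ∎
    where open ≡-Reasoning
  choose-absorb (suc m) (suc i) = begin
    suc (suc i) * (suc m choose suc i + suc m choose suc (suc i))
      ≡⟨ *-distribˡ-+ (suc (suc i)) (suc m choose suc i) _ ⟩
    suc m choose suc i + suc i * (suc m choose suc i) + suc (suc i) * (suc m choose suc (suc i))
      ≡⟨ cong₂ (λ x y → suc m choose suc i + x + y) (choose-absorb m i) (choose-absorb m (suc i)) ⟩
    (m choose i + m choose suc i) + suc m * (m choose i) + suc m * (m choose suc i)
      ≡⟨ solve 3 (λ m x y → (x :+ y) :+ (con 1 :+ m) :* x :+ (con 1 :+ m) :* y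
                            := (con 2 :+ m) :* (x :+ y)) refl m (m choose i) (m choose suc i) ⟩
    suc (suc m) * (m choose i + m choose suc i) ∎
    where open ≡-Reasoning

  -- A single term of the binomial expansion of (c+1)^n, scaled by c^j:
  -- C(n, j) · c^n ≤ (1+c)^n · c^j.
  choose-*-pow≤ : ∀ c n j → (n choose j) * c ^ n ≤ suc c ^ n * c ^ j
  choose-*-pow≤ c zero    zero    = ≤-refl
  choose-*-pow≤ c zero    (suc j) = z≤n
  choose-*-pow≤ c (suc n) zero    = begin
    1 * (c * c ^ n)   ≡⟨ *-identityˡ _ ⟩
    c ^ suc n         ≤⟨ ^-monoˡ-≤ (suc n) (n≤1+n c) ⟩
    suc c ^ suc n     ≡⟨ *-identityʳ _ ⟨
    suc c ^ suc n * 1 ∎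
    where open ≤-Reasoning
  choose-*-pow≤ c (suc n) (suc j) = begin
    (n choose j + n choose suc j) * (c * c ^ n)
      ≡⟨ solve 4 (λ x y c e → (x :+ y) :* (c :* e) := c :* (x :* e) :+ c :* (y :* e))
                 refl (n choose j) (n choose suc j) c (c ^ n) ⟩
    c * ((n choose j) * c ^ n) + c * ((n choose suc j) * c ^ n)
      ≤⟨ +-mono-≤ (*-monoʳ-≤ c (choose-*-pow≤ c n j)) (*-monoʳ-≤ c (choose-*-pow≤ c n (suc j))) ⟩
    c * (suc c ^ n * c ^ j) + c * (suc c ^ n * (c * c ^ j))
      ≡⟨ solve 3 (λ c e f → c :* (e :* f) :+ c :* (e :* (c :* f)) := ((con 1 :+ c) :* e) :* (c :* f))
                 refl c (suc c ^ n) (c ^ j) ⟩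
    (suc c * suc c ^ n) * (c * c ^ j) ∎
    where open ≤-Reasoning

  ^-distrib-* : ∀ m n k → (m * n) ^ k ≡ m ^ k * n ^ k
  ^-distrib-* m n zero    = refl
  ^-distrib-* m n (suc k) = begin
    m * n * (m * n) ^ k       ≡⟨ cong (m * n *_) (^-distrib-* m n k) ⟩
    m * n * (m ^ k * n ^ k)   ≡⟨ solve 4 (λ m n a b → m :* n :* (a :* b) := (m :* a) :* (n :* b))
                                         refl m n (m ^ k) (n ^ k) ⟩
    (m * m ^ k) * (n * n ^ k) ∎
    where open ≡-Reasoning

  poly≤choose : ∀ k L → Eventually (λ n → L * n ^ k ≤ n choose suc k)
  poly≤choose zero L = L , λ n n≥L → begin
    L * 1        ≡⟨ *-identityʳ L ⟩
    L            ≤⟨ n≥L ⟩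
    n            ≡⟨ choose-1 n ⟨
    n choose 1   ∎
    where open ≤-Reasoning
  poly≤choose (suc k) L = suc (N ⊔ 1) , bound
    where
    open ≤-Reasoning
    L′ = suc (suc k) * L * 2 ^ k
    N = proj₁ (poly≤choose k L′)
    bound : ∀ m → m ≥ suc (N ⊔ 1) → L * m ^ suc k ≤ m choose suc (suc k)
    bound (suc n) (s≤s n≥) = *-cancelˡ-≤ (suc (suc k)) (begin
        suc (suc k) * (L * (suc n * suc n ^ k))
          ≡⟨ solve 4 (λ a l s p → a :* (l :* (s :* p)) := s :* (a :* l :* p))
                     refl (suc (suc k)) L (suc n) (suc n ^ k) ⟩
        suc n * (suc (suc k) * L * suc n ^ k)
          ≤⟨ *-monoʳ-≤ (suc n) (*-monoʳ-≤ (suc (suc k) * L) suc-n^k≤) ⟩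
        suc n * (suc (suc k) * L * (2 ^ k * n ^ k))
          ≡⟨ cong (suc n *_) (*-assoc (suc (suc k) * L) (2 ^ k) (n ^ k)) ⟨
        suc n * (L′ * n ^ k)
          ≤⟨ *-monoʳ-≤ (suc n) (proj₂ (poly≤choose k L′) n (m⊔n≤o⇒m≤o N 1 n≥)) ⟩
        suc n * (n choose suc k)
          ≡⟨ choose-absorb n (suc k) ⟨
        suc (suc k) * (suc n choose suc (suc k)) ∎)
      where
      -- for n ≥ 1 we have n+1 ≤ 2n
      suc-n^k≤ : suc n ^ k ≤ 2 ^ k * n ^ k
      suc-n^k≤ = begin
        suc n ^ k   ≤⟨ ^-monoˡ-≤ k (+-monoˡ-≤ n (m⊔n≤o⇒n≤o N 1 n≥)) ⟩
        (n + n) ^ k ≡⟨ cong (_^ k) (solve 1 (λ n → n :+ n := con 2 :* n) refl n) ⟩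
        (2 * n) ^ k ≡⟨ ^-distrib-* 2 n k ⟩
        2 ^ k * n ^ k ∎

  poly*pow≤pow : ∀ c → .{{NonZero c}} → ∀ k K → Eventually (λ n → K * (n ^ k * c ^ n) ≤ suc c ^ n)
  poly*pow≤pow c k K = N , λ n n≥N → *-cancelʳ-≤ _ _ (c ^ suc k) {{m^n≢0 c (suc k)}} (begin
      K * (n ^ k * c ^ n) * c ^ suc k
        ≡⟨ solve 4 (λ K a b d → K :* (a :* b) :* d := K :* d :* a :* b) refl K (n ^ k) (c ^ n) (c ^ suc k) ⟩
      K * c ^ suc k * n ^ k * c ^ n
        ≤⟨ *-monoˡ-≤ (c ^ n) (proj₂ (poly≤choose k (K * c ^ suc k)) n n≥N) ⟩
      (n choose suc k) * c ^ n
        ≤⟨ choose-*-pow≤ c n (suc k) ⟩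
      suc c ^ n * c ^ suc k ∎)
    where
    open ≤-Reasoning
    N = proj₁ (poly≤choose k (K * c ^ suc k))

  ≺-dominated : ∀ {k′ k} → 1 ≤ proj₁ k′ → k′ ≺ k → ∀ K → Eventually (λ n → K * weightℕ k′ n ≤ weightℕ k n)
  ≺-dominated {b , a′} {b , a} _ (inj₂ (refl , a′<a)) K = suc K , bound
    where
    open ≤-Reasoning
    bound : ∀ m → m ≥ suc K → K * (m ^ a′ * b ^ m) ≤ m ^ a * b ^ m
    bound (suc n) (s≤s n≥K) = begin
      K * (suc n ^ a′ * b ^ suc n)   ≡⟨ *-assoc K _ _ ⟨
      K * suc n ^ a′ * b ^ suc n     ≤⟨ *-monoˡ-≤ (b ^ suc n) (*-monoˡ-≤ (suc n ^ a′) (m≤n⇒m≤1+n n≥K)) ⟩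
      suc n ^ suc a′ * b ^ suc n     ≤⟨ *-monoˡ-≤ (b ^ suc n) (^-monoʳ-≤ (suc n) a′<a) ⟩
      suc n ^ a * b ^ suc n          ∎
  ≺-dominated {b′@(suc _) , a′} {b , a} _ (inj₁ b′<b) K = suc N , bound
    where
    open ≤-Reasoning
    N = proj₁ (poly*pow≤pow b′ a′ K)
    bound : ∀ m → m ≥ suc N → K * (m ^ a′ * b′ ^ m) ≤ m ^ a * b ^ m
    bound (suc n) (s≤s n≥N) = begin
      K * (suc n ^ a′ * b′ ^ suc n) ≤⟨ proj₂ (poly*pow≤pow b′ a′ K) (suc n) (m≤n⇒m≤1+n n≥N) ⟩
      suc b′ ^ suc n                ≤⟨ ^-monoˡ-≤ (suc n) b′<b ⟩
      b ^ suc n                     ≤⟨ m≤n*m (b ^ suc n) (suc n ^ a) {{m^n≢0 (suc n) a}} ⟩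
      suc n ^ a * b ^ suc n         ∎

open Growth using (≺-dominated)

open import Data.Integer as ℤ using (+_; -[1+_])
import Data.Integer.Properties as ℤₚ
import Data.Nat.Coprimality as Coprimality
open import Data.Rational
open import Data.Rational.Properties
open import Data.Rational.Solver using (module +-*-Solver)
open +-*-Solver using (solve; _:=_; _:+_; _:*_; _:-_; :-_; con)

ℕ→ℚ≡mkℚ : ∀ k → ℕ→ℚ k ≡ mkℚ (+ k) 0 (Coprimality.sym (Coprimality.1-coprimeTo k))
ℕ→ℚ≡mkℚ k = normalize-coprime (Coprimality.sym (Coprimality.1-coprimeTo k))

ℕ→ℚ-* : ∀ m n → ℕ→ℚ (m ℕ.* n) ≡ ℕ→ℚ m * ℕ→ℚ n
ℕ→ℚ-* m n = trans (cong (_/ 1) (ℤₚ.pos-* m n)) (sym (cong₂ _*_ (ℕ→ℚ≡mkℚ m) (ℕ→ℚ≡mkℚ n)))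

ℕ→ℚ-mono-≤ : ∀ {m n} → m ℕ.≤ n → ℕ→ℚ m ≤ ℕ→ℚ n
ℕ→ℚ-mono-≤ {m} {n} m≤n rewrite ℕ→ℚ≡mkℚ m | ℕ→ℚ≡mkℚ n =
  *≤* (subst₂ ℤ._≤_ (sym (ℤₚ.*-identityʳ (+ m))) (sym (ℤₚ.*-identityʳ (+ n))) (ℤ.+≤+ m≤n))

ℕ→ℚ-nonNeg : ∀ k → 0ℚ ≤ ℕ→ℚ k
ℕ→ℚ-nonNeg k = ℕ→ℚ-mono-≤ {0} {k} z≤n

archimedean : ∀ q → Σ ℕ λ K → q < ℕ→ℚ K
archimedean q@(mkℚ (+ n) d _) = suc n , subst (q <_) (sym (ℕ→ℚ≡mkℚ (suc n)))
  (*<* (subst₂ ℤ._<_ (sym (ℤₚ.*-identityʳ (+ n))) (ℤₚ.pos-* (suc n) (suc d))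
    (ℤ.+<+ (ℕₚ.m≤m*n (suc n) (suc d)))))
archimedean q@(mkℚ -[1+ n ] _ _) = 0 , subst (q <_) (sym (ℕ→ℚ≡mkℚ 0))
  (*<* (subst₂ ℤ._<_ (sym (ℤₚ.*-identityʳ -[1+ n ])) refl ℤ.-<+))

archimedean-scaled : ∀ q ε → ε > 0ℚ → Σ ℕ λ K → q < ε * ℕ→ℚ K
archimedean-scaled q ε ε>0 = K , subst (_< ε * ℕ→ℚ K) ε*[ε⁻¹*q]≡q (*-monoʳ-<-pos ε q/ε<K)
  where
  instance
    _ = positive ε>0
    _ = pos⇒nonZero ε
  K = proj₁ (archimedean (1/ ε * q))
  q/ε<K = proj₂ (archimedean (1/ ε * q))
  ε*[ε⁻¹*q]≡q : ε * (1/ ε * q) ≡ q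
  ε*[ε⁻¹*q]≡q = trans (sym (*-assoc ε (1/ ε) q)) (trans (cong (_* q) (*-inverseʳ ε)) (*-identityˡ q))

half-pos : ∀ {ε} → ε > 0ℚ → ½ * ε > 0ℚ
half-pos {ε} ε>0 = positive⁻¹ (½ * ε) {{pos*pos⇒pos ½ ε {{positive ε>0}}}}

nonNeg-* : ∀ {x y} → 0ℚ ≤ x → 0ℚ ≤ y → 0ℚ ≤ x * y
nonNeg-* {x} {y} 0≤x 0≤y = subst (_≤ x * y) (*-zeroˡ y) (*-monoʳ-≤-nonNeg y {{nonNegative 0≤y}} 0≤x)

neg-involutive : ∀ x → - (- x) ≡ x
neg-involutive x = solve 1 (λ x → :- (:- x) := x) refl x

x≤∣x∣ : ∀ x → x ≤ ∣ x ∣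
x≤∣x∣ x with ∣p∣≡p∨∣p∣≡-p x
... | inj₁ ∣x∣≡x  = ≤-reflexive (sym ∣x∣≡x)
... | inj₂ ∣x∣≡-x = ≤-trans x≤0 (0≤∣p∣ x)
  where
  x≤0 : x ≤ 0ℚ
  x≤0 = subst₂ _≤_ (neg-involutive x) refl (neg-antimono-≤ (subst (0ℚ ≤_) ∣x∣≡-x (0≤∣p∣ x)))

-∣x∣≤x : ∀ x → - ∣ x ∣ ≤ x
-∣x∣≤x x = subst₂ _≤_ (cong -_ (∣-p∣≡∣p∣ x)) (neg-involutive x) (neg-antimono-≤ (x≤∣x∣ (- x)))

∣x-c∣≤e⇒bounds : ∀ {x c e} → ∣ x - c ∣ ≤ e → c - e ≤ x × x ≤ c + e
∣x-c∣≤e⇒bounds {x} {c} {e} ∣x-c∣≤e =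
  subst₂ _≤_ (solve 2 (λ c e → :- e :+ c := c :- e) refl c e) (x-c+c≡x) (+-monoˡ-≤ c lower) ,
  subst₂ _≤_ (x-c+c≡x) (+-comm e c) (+-monoˡ-≤ c upper)
  where
  x-c+c≡x : x - c + c ≡ x
  x-c+c≡x = solve 2 (λ x c → x :- c :+ c := x) refl x c
  lower : - e ≤ x - c
  lower = ≤-trans (neg-antimono-≤ ∣x-c∣≤e) (-∣x∣≤x (x - c))
  upper : x - c ≤ e
  upper = ≤-trans (x≤∣x∣ (x - c)) ∣x-c∣≤e

Negligible : (ℕ → ℚ) → (ℕ → ℚ) → Set
Negligible f g = ∀ ε → ε > 0ℚ → Eventually (λ n → ∣ f n ∣ ≤ ε * g n)

Asymptotic : (ℕ → ℚ) → ℚ → (ℕ → ℚ) → Set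
Asymptotic f α g = Negligible (λ n → f n - α * g n) g

negligible-resp : ∀ {f f′ g} → (∀ n → f n ≡ f′ n) → Negligible f′ g → Negligible f g
negligible-resp {g = g} f≡f′ f′≪g ε ε>0 =
  eventually-map (λ {n} → subst (λ x → ∣ x ∣ ≤ ε * g n) (sym (f≡f′ n))) (f′≪g ε ε>0)

negligible-0 : ∀ {g} → (∀ n → 0ℚ ≤ g n) → Negligible (λ _ → 0ℚ) g
negligible-0 g≥0 ε ε>0 = 0 , λ n _ → nonNeg-* (<⇒≤ ε>0) (g≥0 n)

negligible-+ : ∀ {f h g} → Negligible f g → Negligible h g → Negligible (λ n → f n + h n) g
negligible-+ {f} {h} {g} f≪g h≪g ε ε>0 =
  eventually-map bound (eventually-both (f≪g (½ * ε) (half-pos ε>0)) (h≪g (½ * ε) (half-pos ε>0)))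
  where
  bound : ∀ {n} → ∣ f n ∣ ≤ ½ * ε * g n × ∣ h n ∣ ≤ ½ * ε * g n → ∣ f n + h n ∣ ≤ ε * g n
  bound {n} (f≤ , h≤) = begin
    ∣ f n + h n ∣                 ≤⟨ ∣p+q∣≤∣p∣+∣q∣ (f n) (h n) ⟩
    ∣ f n ∣ + ∣ h n ∣             ≤⟨ +-mono-≤ f≤ h≤ ⟩
    ½ * ε * g n + ½ * ε * g n     ≡⟨ solve 2 (λ e w → con ½ :* e :* w :+ con ½ :* e :* w := e :* w) refl ε (g n) ⟩
    ε * g n                       ∎
    where open ≤-Reasoning

negligible-dominated : ∀ α (W′ W : ℕ → ℕ) → (∀ K → Eventually (λ n → K ℕ.* W′ n ℕ.≤ W n)) →
                       Negligible (λ n → α * ℕ→ℚ (W′ n)) (λ n → ℕ→ℚ (W n))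
negligible-dominated α W′ W W′≪W ε ε>0 = eventually-map bound (W′≪W K)
  where
  K = proj₁ (archimedean-scaled ∣ α ∣ ε ε>0)
  ∣α∣<εK = proj₂ (archimedean-scaled ∣ α ∣ ε ε>0)
  bound : ∀ {n} → K ℕ.* W′ n ℕ.≤ W n → ∣ α * ℕ→ℚ (W′ n) ∣ ≤ ε * ℕ→ℚ (W n)
  bound {n} KW′≤W = begin
    ∣ α * ℕ→ℚ (W′ n) ∣     ≡⟨ ∣p*q∣≡∣p∣*∣q∣ α (ℕ→ℚ (W′ n)) ⟩
    ∣ α ∣ * ∣ ℕ→ℚ (W′ n) ∣ ≡⟨ cong (∣ α ∣ *_) (0≤p⇒∣p∣≡p (ℕ→ℚ-nonNeg (W′ n))) ⟩
    ∣ α ∣ * ℕ→ℚ (W′ n)     ≤⟨ *-monoʳ-≤-nonNeg (ℕ→ℚ (W′ n)) {{nonNegative (ℕ→ℚ-nonNeg (W′ n))}} (<⇒≤ ∣α∣<εK) ⟩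
    ε * ℕ→ℚ K * ℕ→ℚ (W′ n) ≡⟨ *-assoc ε (ℕ→ℚ K) (ℕ→ℚ (W′ n)) ⟩
    ε * (ℕ→ℚ K * ℕ→ℚ (W′ n)) ≡⟨ cong (ε *_) (ℕ→ℚ-* K (W′ n)) ⟨
    ε * ℕ→ℚ (K ℕ.* W′ n)   ≤⟨ *-monoˡ-≤-nonNeg ε {{nonNegative (<⇒≤ ε>0)}} (ℕ→ℚ-mono-≤ KW′≤W) ⟩
    ε * ℕ→ℚ (W n)          ∎
    where open ≤-Reasoning

asymptotic-bounds : ∀ {f α g} → Asymptotic f α g → ∀ ε → ε > 0ℚ →
                    Eventually (λ n → (α - ε) * g n ≤ f n × f n ≤ (α + ε) * g n)
asymptotic-bounds {f} {α} {g} f~αg ε ε>0 = eventually-map band (f~αg ε ε>0)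
  where
  band : ∀ {n} → ∣ f n - α * g n ∣ ≤ ε * g n → (α - ε) * g n ≤ f n × f n ≤ (α + ε) * g n
  band {n} close = subst (_≤ f n) lower≡ (proj₁ bounds) , subst (f n ≤_) upper≡ (proj₂ bounds)
    where
    bounds = ∣x-c∣≤e⇒bounds close
    lower≡ : α * g n - ε * g n ≡ (α - ε) * g n
    lower≡ = solve 3 (λ α e w → α :* w :- e :* w := (α :- e) :* w) refl α ε (g n)
    upper≡ : α * g n + ε * g n ≡ (α + ε) * g n
    upper≡ = solve 3 (λ α e w → α :* w :+ e :* w := (α :+ e) :* w) refl α ε (g n)

eventually-positive : ∀ {f} → EventuallyPositive f → Eventually (λ n → f n > 0ℚ)
eventually-positive (n₀ , f>0) = ℕ.suc n₀ , f>0

positive-not-nonPos : ∀ {f} → EventuallyPositive f → ¬ Eventually (λ n → f n ≤ 0ℚ)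
positive-not-nonPos f>0 f≤0 with eventually-both (eventually-positive f>0) f≤0
... | N , both = <-irrefl refl (<-≤-trans (proj₁ (both N ℕₚ.≤-refl)) (proj₂ (both N ℕₚ.≤-refl)))

-- If f ~ α·g with g ≥ 0 and f is eventually positive, then a nonzero α is positive:
-- a negative α would force f ≤ ½·α·g ≤ 0 eventually.
asymptotic-sign : ∀ {f α g} → (∀ n → 0ℚ ≤ g n) → EventuallyPositive f → Asymptotic f α g → α ≢ 0ℚ → α > 0ℚ
asymptotic-sign {f} {α} {g} g≥0 f>0 f~αg α≢0 with <-cmp α 0ℚ
... | tri> _ _ α>0 = α>0
... | tri≈ _ α≡0 _ = ⊥-elim (α≢0 α≡0)
... | tri< α<0 _ _ = ⊥-elim (positive-not-nonPos f>0 (eventually-map f≤0 (asymptotic-bounds {f} {α} {g} f~αg ε ε>0)))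
  where
  ε = ½ * (- α)
  ε>0 = half-pos (neg-antimono-< α<0)
  α+ε≡½α : α + ε ≡ ½ * α
  α+ε≡½α = solve 1 (λ α → α :+ con ½ :* (:- α) := con ½ :* α) refl α
  ½α<0 : ½ * α < 0ℚ
  ½α<0 = subst (½ * α <_) (*-zeroʳ ½) (*-monoʳ-<-pos ½ α<0)
  f≤0 : ∀ {n} → (α - ε) * g n ≤ f n × f n ≤ (α + ε) * g n → f n ≤ 0ℚ
  f≤0 {n} (_ , f≤) = ≤-trans f≤ (begin
    (α + ε) * g n ≡⟨ cong (_* g n) α+ε≡½α ⟩
    ½ * α * g n   ≤⟨ *-monoʳ-≤-nonNeg (g n) {{nonNegative (g≥0 n)}} (<⇒≤ ½α<0) ⟩
    0ℚ * g n      ≡⟨ *-zeroˡ (g n) ⟩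
    0ℚ            ∎)
    where open ≤-Reasoning

asymptotic-converges : ∀ {f α g} → (∀ n → g n ≡ 1ℚ) → Asymptotic f α g → f ⟶ α
asymptotic-converges {f} {α} {g} g≡1 f~αg ε ε>0 = eventually-map close (f~αg (½ * ε) (half-pos ε>0))
  where
  ½ε<ε : ½ * ε < ε
  ½ε<ε = subst₂ _<_ (+-identityˡ (½ * ε)) ½ε+½ε≡ε (+-monoˡ-< (½ * ε) (half-pos ε>0))
    where
    ½ε+½ε≡ε : ½ * ε + ½ * ε ≡ ε
    ½ε+½ε≡ε = solve 1 (λ e → con ½ :* e :+ con ½ :* e := e) refl ε
  close : ∀ {n} → ∣ f n - α * g n ∣ ≤ ½ * ε * g n → ∣ f n - α ∣ < ε
  close {n} ≤½εg = ≤-<-trans (subst₂ (λ x y → ∣ f n - x ∣ ≤ y) α*g≡α ½ε*g≡½ε ≤½εg) ½ε<ε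
    where
    α*g≡α : α * g n ≡ α
    α*g≡α = trans (cong (α *_) (g≡1 n)) (*-identityʳ α)
    ½ε*g≡½ε : ½ * ε * g n ≡ ½ * ε
    ½ε*g≡½ε = trans (cong (½ * ε *_) (g≡1 n)) (*-identityʳ (½ * ε))

-- A positive multiple of an unbounded weight diverges: eventually f ≥ ½·α·W n,
-- and W n exceeds any prescribed natural number.
asymptotic-diverges : ∀ {f α} (W : ℕ → ℕ) → α > 0ℚ → Asymptotic f α (λ n → ℕ→ℚ (W n)) →
                      (∀ K → Eventually (λ n → K ℕ.≤ W n)) → f ⟶+∞
asymptotic-diverges {f} {α} W α>0 f~αW W-unbounded M =
  eventually-map above (eventually-both (W-unbounded K) (asymptotic-bounds {f} {α} f~αW (½ * α) (half-pos α>0)))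
  where
  K = proj₁ (archimedean-scaled M (½ * α) (half-pos α>0))
  M<½αK = proj₂ (archimedean-scaled M (½ * α) (half-pos α>0))
  α-½α≡½α : α - ½ * α ≡ ½ * α
  α-½α≡½α = solve 1 (λ α → α :- con ½ :* α := con ½ :* α) refl α
  above : ∀ {n} → K ℕ.≤ W n × ((α - ½ * α) * ℕ→ℚ (W n) ≤ f n × f n ≤ (α + ½ * α) * ℕ→ℚ (W n)) → f n > M
  above {n} (K≤W , lower , _) = begin-strict
    M                         <⟨ M<½αK ⟩
    ½ * α * ℕ→ℚ K             ≤⟨ *-monoˡ-≤-nonNeg (½ * α) {{nonNegative (<⇒≤ (half-pos α>0))}} (ℕ→ℚ-mono-≤ K≤W) ⟩
    ½ * α * ℕ→ℚ (W n)         ≡⟨ cong (_* ℕ→ℚ (W n)) α-½α≡½α ⟨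
    (α - ½ * α) * ℕ→ℚ (W n)   ≤⟨ lower ⟩
    f n                       ∎
    where open ≤-Reasoning

limPositive⇒eventuallyPositive : ∀ f → LimPositive f → EventuallyPositive f
limPositive⇒eventuallyPositive f (inj₁ f⟶∞) = proj₁ (f⟶∞ 0ℚ) , λ n n>N → proj₂ (f⟶∞ 0ℚ) n (ℕₚ.<⇒≤ n>N)
limPositive⇒eventuallyPositive f (inj₂ (c , c>0 , f⟶c)) = proj₁ (f⟶c c c>0) , f>0
  where
  f>0 : ∀ n → n ℕ.> proj₁ (f⟶c c c>0) → f n > 0ℚ
  f>0 n n>N = subst₂ _<_ -c+c≡0 f-c+c≡f (+-monoˡ-< c -c<f-c)
    where
    -c<f-c : - c < f n - c
    -c<f-c = <-≤-trans (neg-antimono-< (proj₂ (f⟶c c c>0) n (ℕₚ.<⇒≤ n>N))) (-∣x∣≤x (f n - c))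
    -c+c≡0 : - c + c ≡ 0ℚ
    -c+c≡0 = +-inverseˡ c
    f-c+c≡f : f n - c + c ≡ f n
    f-c+c≡f = solve 2 (λ x c → x :- c :+ c := x) refl (f n) c

key : Term → Key
key t = Term.b t , Term.a t

weight : Key → ℕ → ℚ
weight k n = ℕ→ℚ (weightℕ k n)

weight-nonNeg : ∀ k n → 0ℚ ≤ weight k n
weight-nonNeg k n = ℕ→ℚ-nonNeg (weightℕ k n)

lower-terms-negligible : ∀ k r → All (λ t → key t ≺ k) r → Negligible (eval r) (weight k)
lower-terms-negligible k []      []            = negligible-0 (weight-nonNeg k)
lower-terms-negligible k (t ∷ r) (t≺k ∷ r≺k) = negligible-+
  (negligible-dominated (Term.α t) (weightℕ (key t)) (weightℕ k) (≺-dominated (Term.b≥1 t) t≺k))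
  (lower-terms-negligible k r r≺k)

_≟ₖ_ : (k k′ : Key) → Dec (k ≡ k′)
_≟ₖ_ = ≡-dec ℕₚ._≟_ ℕₚ._≟_

coefficient : Key → NPE → ℚ
coefficient k []      = 0ℚ
coefficient k (t ∷ p) with key t ≟ₖ k
... | yes _ = Term.α t + coefficient k p
... | no  _ = coefficient k p

without : Key → NPE → NPE
without k = filter (λ t → ¬? (key t ≟ₖ k))

split : ∀ k p n → eval p n ≡ coefficient k p * weight k n + eval (without k p) n
split k []      n = solve 1 (λ w → con 0ℚ := con 0ℚ :* w :+ con 0ℚ) refl (weight k n)
split k (t ∷ p) n with key t ≟ₖ k
... | yes refl = begin
  evalTerm t n + eval p n
    ≡⟨ cong (λ x → evalTerm t n + x) (split k p n) ⟩
  Term.α t * weight k n + (coefficient k p * weight k n + eval (without k p) n)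
    ≡⟨ solve 4 (λ α w c e → α :* w :+ (c :* w :+ e) := (α :+ c) :* w :+ e)
               refl (Term.α t) (weight k n) (coefficient k p) (eval (without k p) n) ⟩
  (Term.α t + coefficient k p) * weight k n + eval (without k p) n ∎
  where open ≡-Reasoning
... | no ≢k = begin
  evalTerm t n + eval p n
    ≡⟨ cong (λ x → evalTerm t n + x) (split k p n) ⟩
  evalTerm t n + (coefficient k p * weight k n + eval (without k p) n)
    ≡⟨ solve 4 (λ x w c e → x :+ (c :* w :+ e) := c :* w :+ (x :+ e))
               refl (evalTerm t n) (weight k n) (coefficient k p) (eval (without k p) n) ⟩
  coefficient k p * weight k n + (evalTerm t n + eval (without k p) n) ∎
  where open ≡-Reasoning

_≼_ : Key → Key → Set
_≼_ = LexNonStrict.×-Lex _≡_ ℕ._≤_ ℕ._≤_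

≼∧≢⇒≺ : ∀ {k′ k} → k′ ≼ k → k′ ≢ k → k′ ≺ k
≼∧≢⇒≺ (inj₁ (b′≤b , b′≢b)) _ = inj₁ (ℕₚ.≤∧≢⇒< b′≤b b′≢b)
≼∧≢⇒≺ {b , a′} {b , a} (inj₂ (refl , a′≤a)) k′≢k = inj₂ (refl , ℕₚ.≤∧≢⇒< a′≤a (λ a′≡a → k′≢k (cong (b ,_) a′≡a)))

asymptotic-top : ∀ k p → All (λ t → key t ≼ k) p → Asymptotic (eval p) (coefficient k p) (weight k)
asymptotic-top k p p≼k = negligible-resp rest≡
  (lower-terms-negligible k (without k p) (All.map (uncurry ≼∧≢⇒≺) (All.zip (filter⁺ _ p≼k , all-filter _ p))))
  where
  rest≡ : ∀ n → eval p n - coefficient k p * weight k n ≡ eval (without k p) n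
  rest≡ n = begin
    eval p n - coefficient k p * weight k n
      ≡⟨ cong (_- coefficient k p * weight k n) (split k p n) ⟩
    coefficient k p * weight k n + eval (without k p) n - coefficient k p * weight k n
      ≡⟨ solve 3 (λ c w e → c :* w :+ e :- c :* w := e) refl (coefficient k p) (weight k n) (eval (without k p) n) ⟩
    eval (without k p) n ∎
    where open ≡-Reasoning

topKey : Term → NPE → Key
topKey h p = key (argmax key h p)

topKey-max : ∀ h p → All (λ t → key t ≼ topKey h p) (h ∷ p)
topKey-max h p = f[⊥]≤f[argmax] {f = key} h p ∷ f[xs]≤f[argmax] {f = key} h p

topKey-occurs : ∀ h p → Any (λ t → key t ≡ topKey h p) (h ∷ p)
topKey-occurs h p with argmax-sel key h p
... | inj₁ top≡h = here (cong key (sym top≡h))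
... | inj₂ top∈p = there (Any.map (λ top≡t → cong key (sym top≡t)) top∈p)

topKey-base : ∀ h p → 1 ℕ.≤ proj₁ (topKey h p)
topKey-base h p = argmax-all key {P = λ t → 1 ℕ.≤ Term.b t} {h} {p} (Term.b≥1 h) (All.tabulate λ {t} _ → Term.b≥1 t)

LeadingTerm : (ℕ → ℚ) → Set
LeadingTerm f = Σ Key λ k → Σ ℚ λ α → 1 ℕ.≤ proj₁ k × α ≢ 0ℚ × Asymptotic f α (weight k)

Classified : (ℕ → ℚ) → Set
Classified f = (∀ n → f n ≡ 0ℚ) ⊎ LeadingTerm f

classified-resp : ∀ {f g} → (∀ n → f n ≡ g n) → Classified g → Classified f
classified-resp f≡g (inj₁ g≡0) = inj₁ (λ n → trans (f≡g n) (g≡0 n))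
classified-resp f≡g (inj₂ (k , α , b≥1 , α≢0 , g~αw)) =
  inj₂ (k , α , b≥1 , α≢0 , negligible-resp (λ n → cong (_- α * weight k n) (f≡g n)) g~αw)

-- By well-founded recursion on the number of summands: if the coefficient of the top
-- key is nonzero it gives the leading term; otherwise drop that key and recurse.
classify : ∀ p → Classified (eval p)
classify p = go p (<-wellFounded (length p))
  where
  go : ∀ p → Acc ℕ._<_ (length p) → Classified (eval p)
  go []      _         = inj₁ (λ _ → refl)
  go (h ∷ p) (acc rec) with coefficient (topKey h p) (h ∷ p) ≟ 0ℚ
  ... | no c≢0  = inj₂ (k , c , topKey-base h p , c≢0 , asymptotic-top k (h ∷ p) (topKey-max h p))
    where
    k = topKey h p
    c = coefficient k (h ∷ p)
  ... | yes c≡0 = classified-resp p≡rest (go (without k (h ∷ p)) (rec shorter))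
    where
    k = topKey h p
    shorter : length (without k (h ∷ p)) ℕ.< length (h ∷ p)
    shorter = filter-notAll (λ t → ¬? (key t ≟ₖ k)) (h ∷ p) (Any.map (λ eq ≢k → ≢k eq) (topKey-occurs h p))
    p≡rest : ∀ n → eval (h ∷ p) n ≡ eval (without k (h ∷ p)) n
    p≡rest n = begin
      eval (h ∷ p) n                                                ≡⟨ split k (h ∷ p) n ⟩
      coefficient k (h ∷ p) * weight k n + eval (without k (h ∷ p)) n ≡⟨ cong (λ c → c * weight k n + eval (without k (h ∷ p)) n) c≡0 ⟩
      0ℚ * weight k n + eval (without k (h ∷ p)) n                  ≡⟨ solve 2 (λ w e → con 0ℚ :* w :+ e := e) refl (weight k n) (eval (without k (h ∷ p)) n) ⟩
      eval (without k (h ∷ p)) n                                    ∎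
      where open ≡-Reasoning

weightℕ-unit : ∀ n → weightℕ (1 , 0) n ≡ 1
weightℕ-unit n = trans (ℕₚ.*-identityˡ (1 ℕ.^ n)) (ℕₚ.^-zeroˡ n)

unit-or-above : ∀ k → 1 ℕ.≤ proj₁ k → k ≡ (1 , 0) ⊎ (1 , 0) ≺ k
unit-or-above (suc zero    , zero)  _ = inj₁ refl
unit-or-above (suc zero    , suc a) _ = inj₂ (inj₂ (refl , s≤s z≤n))
unit-or-above (suc (suc b) , a)     _ = inj₂ (inj₁ (s≤s (s≤s z≤n)))

positive-leading⇒limPositive : ∀ {f α} k → 1 ℕ.≤ proj₁ k → α > 0ℚ → Asymptotic f α (weight k) → LimPositive f
positive-leading⇒limPositive {f} {α} k b≥1 α>0 f~αw with unit-or-above k b≥1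
... | inj₁ refl   = inj₂ (α , α>0 , asymptotic-converges {f} (λ n → cong ℕ→ℚ (weightℕ-unit n)) f~αw)
... | inj₂ unit≺k = inj₁ (asymptotic-diverges (weightℕ k) α>0 f~αw unbounded)
  where
  unbounded : ∀ K → Eventually (λ n → K ℕ.≤ weightℕ k n)
  unbounded K = eventually-map (λ {n} → subst (ℕ._≤ weightℕ k n) (K*unit≡K n)) (≺-dominated (s≤s z≤n) unit≺k K)
    where
    K*unit≡K : ∀ n → K ℕ.* weightℕ (1 , 0) n ≡ K
    K*unit≡K n = trans (cong (K ℕ.*_) (weightℕ-unit n)) (ℕₚ.*-identityʳ K)

eventuallyPositive⇒limPositive : ∀ p → EventuallyPositive (eval p) → LimPositive (eval p)
eventuallyPositive⇒limPositive p p>0 with classify p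
... | inj₁ p≡0 = ⊥-elim (positive-not-nonPos p>0 (0 , λ n _ → ≤-reflexive (p≡0 n)))
... | inj₂ (k , α , b≥1 , α≢0 , p~αw) =
  positive-leading⇒limPositive k b≥1 (asymptotic-sign (weight-nonNeg k) p>0 p~αw α≢0) p~αw

lemma9 : (p : NPE) → (EventuallyPositive (eval p) → LimPositive (eval p)) × (LimPositive (eval p) → EventuallyPositive (eval p))
lemma9 p = eventuallyPositive⇒limPositive p , limPositive⇒eventuallyPositive (eval p)
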